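{- Define integers $P(n,k)$ for integers $0\le k\le n$ by $P(n,0)=2^n-1$, $P(n,n)=2^{n-2}n(n-1)+2^n-1$ for $n\ge1$ (and $P(0,0)=0$), and for $0<k<n$: $P(n,k)=P(n-1,k)+P(n-1,k-1)+k2^{k-1}+2^{n-1}$. Then for all integers $0\le k\le n$, with $m=\min(k,n-k)$, $$P(n,k)\le 2^{n-2}\left(\left(k-\frac m2-\frac74\right)^2+\frac{9k}{2}+\frac{79}{16}\right)+2^k\left(\frac32\right)^m\left(\frac k2-\frac m6\right)-2^k(k+1)-2^{n-k}\left(\frac32\right)^m.$$
   Context: $P(n,k)$ is the number of comparators of the Pairwise Half-Bitonic Selection Network selecting the $2^k$ largest of $2^n$ inputs. -}

module Defs where

open import Data.Nat using (ℕ; zero; suc; _+_; _*_; _∸_; _^_; _≟_)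
open import Data.Integer using (+_)
open import Data.Rational using (ℚ; _/_; 1ℚ) renaming (_+_ to _+ℚ_; _*_ to _*ℚ_; _-_ to _-ℚ_)
open import Relation.Nullary using (yes; no)

Pdiag : ℕ → ℕ
Pdiag zero = 0
Pdiag (suc zero) = 1
Pdiag (suc (suc j)) = 2 ^ j * (j + 2) * (j + 1) + 2 ^ (j + 2) ∸ 1

-- P n k, meaningful for 0 ≤ k ≤ n (values for k > n are irrelevant junk).
P : ℕ → ℕ → ℕ
P zero k = 0
P (suc n) zero = 2 ^ suc n ∸ 1
P (suc n) (suc k) with suc k ≟ suc n
... | yes _ = Pdiag (suc n)
... | no _ = P n (suc k) + P n k + suc k * 2 ^ k + 2 ^ n

ℕtoℚ : ℕ → ℚ
ℕtoℚ n = (+ n) / 1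

_^ℚ_ : ℚ → ℕ → ℚ
q ^ℚ zero = 1ℚ
q ^ℚ suc m = q *ℚ (q ^ℚ m)

-- right-hand side of the bound, with m = min(k, n-k) passed explicitly
bound : ℕ → ℕ → ℕ → ℚ
bound n k m =
  ((ℕtoℚ (2 ^ n) *ℚ ((+ 1) / 4)) *ℚ
     ((X *ℚ X) +ℚ (((+ 9) / 2) *ℚ ℕtoℚ k) +ℚ ((+ 79) / 16)))
  +ℚ ((ℕtoℚ (2 ^ k) *ℚ (h ^ℚ m)) *ℚ ((ℕtoℚ k *ℚ ((+ 1) / 2)) -ℚ (ℕtoℚ m *ℚ ((+ 1) / 6))))
  -ℚ (ℕtoℚ (2 ^ k) *ℚ ℕtoℚ (k + 1))
  -ℚ (ℕtoℚ (2 ^ (n ∸ k)) *ℚ (h ^ℚ m))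
  where
  h : ℚ
  h = (+ 3) / 2
  X : ℚ
  X = (ℕtoℚ k -ℚ (ℕtoℚ m *ℚ ((+ 1) / 2))) -ℚ ((+ 7) / 4)

-- Write U n k for the right-hand side, bound n k (min k (n - k)). U agrees with P for
-- k = 0 and for k = n, and it satisfies the recurrence of P with ≤ in place of =, so P ≤ U
-- by induction on n. To check the recurrence, write k = a + m and n - k = b + m with
-- m = min (k, n - k), where a = 0 or b = 0; then U n k is a polynomial in m, a, 2^m, 3^m, 2^a
-- and 2^b. Comparing n - 1 - k with k gives three regimes in which the three values of U in
-- the recurrence share these atoms, and in each regime the defect of the recurrence is, as a
-- polynomial identity, an expression that is visibly nonnegative because 3^m ≤ 4^m and
-- 2^j ≥ 1, apart from a few small cases that are checked separately.

module Submission where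

open import Defs
open import Level using (0ℓ)
open import Algebra.Bundles.Raw using (RawRing)
open import Data.Empty using (⊥-elim)
open import Data.Product using (_,_)
open import Data.Sum using (_⊎_; inj₁; inj₂; [_,_]′)
open import Data.Nat
  using (ℕ; NonZero; zero; suc; _+_; _*_; _^_; _∸_; _⊓_; _≤_; _<_; s≤s; compare; less; equal; greater)
import Data.Nat.Properties as ℕ
open import Data.Nat.Tactic.RingSolver using () renaming (solve to solveℕ)
open import Data.List using (_∷_; [])
open import Data.Integer as ℤ using (+_)
import Data.Integer.Properties as ℤ
open import Data.Rational using (ℚ; _/_; 0ℚ; 1ℚ; toℚᵘ; +-*-rawRing; nonNegative)
  renaming (_+_ to _+ℚ_; _*_ to _*ℚ_; _-_ to _-ℚ_; _≤_ to _≤ℚ_)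
open import Data.Rational.Properties
  using (toℚᵘ-injective; toℚᵘ-fromℚᵘ; toℚᵘ-homo-+; toℚᵘ-homo-*; normalize-nonNeg; nonNegative⁻¹;
         nonNeg*nonNeg⇒nonNeg; +-mono-≤; +-monoˡ-≤; +-monoʳ-≤; +-identityʳ; *-identityˡ; *-assoc;
         ≤-reflexive; ≤ᵇ⇒≤; module ≤-Reasoning)
open import Data.Rational.Unnormalised as ℚᵘ using (mkℚᵘ; *≡*)
import Data.Rational.Unnormalised.Properties as ℚᵘ
open import Data.Rational.Solver using (module +-*-Solver)
open +-*-Solver using (Polynomial; _:+_; _:*_; _:-_; :-_; con; solve; _:=_)
open import Function using (id)
open import Relation.Nullary using (yes; no)
open import Relation.Binary.PropositionalEquality
  using (_≡_; refl; sym; trans; cong; cong₂; subst; subst₂; module ≡-Reasoning)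

toℚᵘ-ℕtoℚ : ∀ n → toℚᵘ (ℕtoℚ n) ℚᵘ.≃ mkℚᵘ (+ n) 0
toℚᵘ-ℕtoℚ n = toℚᵘ-fromℚᵘ (mkℚᵘ (+ n) 0)

ℕtoℚ-+ : ∀ m n → ℕtoℚ (m + n) ≡ ℕtoℚ m +ℚ ℕtoℚ n
ℕtoℚ-+ m n = toℚᵘ-injective (begin
  toℚᵘ (ℕtoℚ (m + n))                ≈⟨ toℚᵘ-ℕtoℚ (m + n) ⟩
  mkℚᵘ (+ (m + n)) 0                  ≈⟨ *≡* (cong (ℤ._* + 1) numerators) ⟩
  mkℚᵘ (+ m) 0 ℚᵘ.+ mkℚᵘ (+ n) 0      ≈⟨ ℚᵘ.+-cong (toℚᵘ-ℕtoℚ m) (toℚᵘ-ℕtoℚ n) ⟨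
  toℚᵘ (ℕtoℚ m) ℚᵘ.+ toℚᵘ (ℕtoℚ n)    ≈⟨ toℚᵘ-homo-+ (ℕtoℚ m) (ℕtoℚ n) ⟨
  toℚᵘ (ℕtoℚ m +ℚ ℕtoℚ n)             ∎)
  where
  open ℚᵘ.≃-Reasoning
  numerators : + (m + n) ≡ + m ℤ.* + 1 ℤ.+ + n ℤ.* + 1
  numerators = trans (ℤ.pos-+ m n) (sym (cong₂ ℤ._+_ (ℤ.*-identityʳ (+ m)) (ℤ.*-identityʳ (+ n))))

ℕtoℚ-* : ∀ m n → ℕtoℚ (m * n) ≡ ℕtoℚ m *ℚ ℕtoℚ n
ℕtoℚ-* m n = toℚᵘ-injective (begin
  toℚᵘ (ℕtoℚ (m * n))                ≈⟨ toℚᵘ-ℕtoℚ (m * n) ⟩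
  mkℚᵘ (+ (m * n)) 0                  ≈⟨ *≡* (cong (ℤ._* + 1) (ℤ.pos-* m n)) ⟩
  mkℚᵘ (+ m) 0 ℚᵘ.* mkℚᵘ (+ n) 0      ≈⟨ ℚᵘ.*-cong (toℚᵘ-ℕtoℚ m) (toℚᵘ-ℕtoℚ n) ⟨
  toℚᵘ (ℕtoℚ m) ℚᵘ.* toℚᵘ (ℕtoℚ n)    ≈⟨ toℚᵘ-homo-* (ℕtoℚ m) (ℕtoℚ n) ⟨
  toℚᵘ (ℕtoℚ m *ℚ ℕtoℚ n)             ∎)
  where open ℚᵘ.≃-Reasoning

ℕtoℚ-∸ : ∀ {m n} → n ≤ m → ℕtoℚ (m ∸ n) ≡ ℕtoℚ m -ℚ ℕtoℚ n
ℕtoℚ-∸ {m} {n} n≤m = begin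
  ℕtoℚ (m ∸ n)                           ≡⟨ cancel (ℕtoℚ (m ∸ n)) (ℕtoℚ n) ⟨
  ℕtoℚ (m ∸ n) +ℚ ℕtoℚ n -ℚ ℕtoℚ n       ≡⟨ cong (_-ℚ ℕtoℚ n) (ℕtoℚ-+ (m ∸ n) n) ⟨
  ℕtoℚ (m ∸ n + n) -ℚ ℕtoℚ n             ≡⟨ cong (λ x → ℕtoℚ x -ℚ ℕtoℚ n) (ℕ.m∸n+n≡m n≤m) ⟩
  ℕtoℚ m -ℚ ℕtoℚ n                       ∎
  where
  open ≡-Reasoning
  cancel : ∀ x y → x +ℚ y -ℚ y ≡ x
  cancel = solve 2 (λ x y → x :+ y :- y := x) refl

0≤+/ : ∀ m n .{{_ : NonZero n}} → 0ℚ ≤ℚ + m / n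
0≤+/ m n = nonNegative⁻¹ (+ m / n) {{normalize-nonNeg m n}}

0≤ℕtoℚ : ∀ n → 0ℚ ≤ℚ ℕtoℚ n
0≤ℕtoℚ n = 0≤+/ n 1

-- Supersolutions of the recurrence dominate P

P-column-zero : ∀ n → P n 0 ≡ 2 ^ n ∸ 1
P-column-zero zero = refl
P-column-zero (suc n) = refl

P-diagonal : ∀ n → P n n ≡ Pdiag n
P-diagonal zero = refl
P-diagonal (suc n) with suc n ℕ.≟ suc n
... | yes _ = refl
... | no n≢n = ⊥-elim (n≢n refl)

P-step : ∀ {n k} → k < n → P (suc n) (suc k) ≡ P n (suc k) + P n k + (suc k * 2 ^ k + 2 ^ n)
P-step {n} {k} k<n with suc k ℕ.≟ suc n
... | yes k≡n = ⊥-elim (ℕ.<⇒≢ k<n (ℕ.suc-injective k≡n))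
... | no _ = ℕ.+-assoc (P n (suc k) + P n k) (suc k * 2 ^ k) (2 ^ n)

ℕtoℚ-P-step : ∀ {n k} → k < n →
  ℕtoℚ (P (suc n) (suc k)) ≡ ℕtoℚ (P n (suc k)) +ℚ ℕtoℚ (P n k) +ℚ ℕtoℚ (suc k * 2 ^ k + 2 ^ n)
ℕtoℚ-P-step {n} {k} k<n = begin
  ℕtoℚ (P (suc n) (suc k))                                   ≡⟨ cong ℕtoℚ (P-step k<n) ⟩
  ℕtoℚ (P n (suc k) + P n k + c)                             ≡⟨ ℕtoℚ-+ (P n (suc k) + P n k) c ⟩
  ℕtoℚ (P n (suc k) + P n k) +ℚ ℕtoℚ c
                                    ≡⟨ cong (_+ℚ ℕtoℚ c) (ℕtoℚ-+ (P n (suc k)) (P n k)) ⟩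
  ℕtoℚ (P n (suc k)) +ℚ ℕtoℚ (P n k) +ℚ ℕtoℚ c              ∎
  where
  open ≡-Reasoning
  c = suc k * 2 ^ k + 2 ^ n

SupersolutionAt : (ℕ → ℕ → ℚ) → ℕ → ℕ → Set
SupersolutionAt U n k = U n (suc k) +ℚ U n k +ℚ ℕtoℚ (suc k * 2 ^ k + 2 ^ n) ≤ℚ U (suc n) (suc k)

Supersolution : (ℕ → ℕ → ℚ) → Set
Supersolution U = ∀ {n k} → k < n → SupersolutionAt U n k

module _ (U : ℕ → ℕ → ℚ) (column : ∀ n → ℕtoℚ (P n 0) ≤ℚ U n 0)
         (diagonal : ∀ n → ℕtoℚ (P n n) ≤ℚ U n n) (super : Supersolution U) where

  P≤supersolution : ∀ {n k} → k ≤ n → ℕtoℚ (P n k) ≤ℚ U n k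
  P≤supersolution {n} {zero} _ = column n
  P≤supersolution {suc n} {suc k} (s≤s k≤n) =
    [ step , (λ { refl → diagonal (suc k) }) ]′ (ℕ.m≤n⇒m<n∨m≡n k≤n)
    where
    step : k < n → ℕtoℚ (P (suc n) (suc k)) ≤ℚ U (suc n) (suc k)
    step k<n = begin
      ℕtoℚ (P (suc n) (suc k))                                                 ≡⟨ ℕtoℚ-P-step k<n ⟩
      ℕtoℚ (P n (suc k)) +ℚ ℕtoℚ (P n k) +ℚ ℕtoℚ (suc k * 2 ^ k + 2 ^ n)
        ≤⟨ +-monoˡ-≤ _ (+-mono-≤ (P≤supersolution k<n) (P≤supersolution (ℕ.<⇒≤ k<n))) ⟩
      U n (suc k) +ℚ U n k +ℚ ℕtoℚ (suc k * 2 ^ k + 2 ^ n)                     ≤⟨ super k<n ⟩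
      U (suc n) (suc k)                                                        ∎
      where open ≤-Reasoning

-- The bound as a polynomial in powers of 2 and 3

-- Equal to ℕtoℚ (ℕtoℚ≡fromℕ), but computing on suc, so that the atoms of splitBound at
-- successor indices reduce to the shapes in which the ring-solver identities are stated.
fromℕ : ℕ → ℚ
fromℕ zero = 0ℚ
fromℕ (suc n) = 1ℚ +ℚ fromℕ n

ℕtoℚ≡fromℕ : ∀ n → ℕtoℚ n ≡ fromℕ n
ℕtoℚ≡fromℕ zero = refl
ℕtoℚ≡fromℕ (suc n) = trans (ℕtoℚ-+ 1 n) (cong (1ℚ +ℚ_) (ℕtoℚ≡fromℕ n))

ℕtoℚ-+-fromℕ : ∀ m n → ℕtoℚ (m + n) ≡ fromℕ m +ℚ fromℕ n
ℕtoℚ-+-fromℕ m n = trans (ℕtoℚ-+ m n) (cong₂ _+ℚ_ (ℕtoℚ≡fromℕ m) (ℕtoℚ≡fromℕ n))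

^ℚ-+ : ∀ q m n → q ^ℚ (m + n) ≡ q ^ℚ m *ℚ q ^ℚ n
^ℚ-+ q zero n = sym (*-identityˡ (q ^ℚ n))
^ℚ-+ q (suc m) n = trans (cong (q *ℚ_) (^ℚ-+ q m n)) (sym (*-assoc q (q ^ℚ m) (q ^ℚ n)))

^ℚ-distribʳ-* : ∀ p q n → (p *ℚ q) ^ℚ n ≡ p ^ℚ n *ℚ q ^ℚ n
^ℚ-distribʳ-* p q zero = refl
^ℚ-distribʳ-* p q (suc n) =
  trans (cong ((p *ℚ q) *ℚ_) (^ℚ-distribʳ-* p q n)) (interchange p q (p ^ℚ n) (q ^ℚ n))
  where
  interchange : ∀ a b c d → a *ℚ b *ℚ (c *ℚ d) ≡ a *ℚ c *ℚ (b *ℚ d)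
  interchange = solve 4 (λ a b c d → a :* b :* (c :* d) := a :* c :* (b :* d)) refl

ℕtoℚ-^ : ∀ m n → ℕtoℚ (m ^ n) ≡ ℕtoℚ m ^ℚ n
ℕtoℚ-^ m zero = refl
ℕtoℚ-^ m (suc n) = trans (ℕtoℚ-* m (m ^ n)) (cong (ℕtoℚ m *ℚ_) (ℕtoℚ-^ m n))

two three threeHalves : ℚ
two = ℕtoℚ 2
three = ℕtoℚ 3
threeHalves = + 3 / 2

2^-+ : ∀ m n → ℕtoℚ (2 ^ (m + n)) ≡ two ^ℚ m *ℚ two ^ℚ n
2^-+ m n = trans (ℕtoℚ-^ 2 (m + n)) (^ℚ-+ two m n)

2^*threeHalves^ : ∀ a m → ℕtoℚ (2 ^ (a + m)) *ℚ threeHalves ^ℚ m ≡ two ^ℚ a *ℚ three ^ℚ m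
2^*threeHalves^ a m = begin
  ℕtoℚ (2 ^ (a + m)) *ℚ threeHalves ^ℚ m     ≡⟨ cong (_*ℚ threeHalves ^ℚ m) (2^-+ a m) ⟩
  two ^ℚ a *ℚ two ^ℚ m *ℚ threeHalves ^ℚ m   ≡⟨ *-assoc (two ^ℚ a) (two ^ℚ m) (threeHalves ^ℚ m) ⟩
  two ^ℚ a *ℚ (two ^ℚ m *ℚ threeHalves ^ℚ m) ≡⟨ cong (two ^ℚ a *ℚ_) (^ℚ-distribʳ-* two threeHalves m) ⟨
  two ^ℚ a *ℚ three ^ℚ m                     ∎
  where open ≡-Reasoning

-- bound n k m is, by definition, boundExpr over ℚ applied to 2^n, k, m, 2^k, 2^k (3/2)^m,
-- 2^(n-k) (3/2)^m and k + 1; stated over any raw ring it is also available as solver syntax.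
module BoundShape (R : RawRing 0ℓ 0ℓ) (κ : ℚ → RawRing.Carrier R) where
  open RawRing R using (Carrier) renaming (_+_ to _⊕_; _*_ to _⊗_; -_ to ⊝_)

  infixl 6 _⊖_
  _⊖_ : Carrier → Carrier → Carrier
  x ⊖ y = x ⊕ ⊝ y

  boundExpr : (N K M T U V K₁ : Carrier) → Carrier
  boundExpr N K M T U V K₁ =
    N ⊗ κ (+ 1 / 4) ⊗ (X ⊗ X ⊕ κ (+ 9 / 2) ⊗ K ⊕ κ (+ 79 / 16))
    ⊕ U ⊗ (K ⊗ κ (+ 1 / 2) ⊖ M ⊗ κ (+ 1 / 6))
    ⊖ T ⊗ K₁
    ⊖ V
    where
    X : Carrier
    X = K ⊖ M ⊗ κ (+ 1 / 2) ⊖ κ (+ 7 / 4)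

  -- The bound at k = a + m, n - k = b + m in the atoms p = 2^m, t = 3^m, α = 2^a, β = 2^b,
  -- and the merge term (k + 1) 2^k + 2^n of the recurrence there.
  splitExpr : (a m p t α β : Carrier) → Carrier
  splitExpr a m p t α β =
    boundExpr (α ⊗ p ⊗ (β ⊗ p)) (a ⊕ m) m (α ⊗ p) (α ⊗ t) (β ⊗ t) (a ⊕ m ⊕ κ 1ℚ)

  mergeExpr : (a m p α β : Carrier) → Carrier
  mergeExpr a m p α β = (κ 1ℚ ⊕ (a ⊕ m)) ⊗ (α ⊗ p) ⊕ α ⊗ p ⊗ (β ⊗ p)

  -- The defect of the recurrence at n = 2k + 2 + j, resp. at n = 2s + 2 + j and k = s + 1 + j,
  -- in shapes that are visibly nonnegative once k ≥ 2, resp. j ≥ 2.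
  lowerSlack : (K P T D : Carrier) → Carrier
  lowerSlack K P T D =
    (P ⊗ P ⊖ T) ⊗ D ⊗ (K ⊖ κ two) ⊗ κ (+ 1 / 2)
    ⊕ T ⊗ K ⊗ (κ three ⊗ (D ⊖ κ 1ℚ) ⊕ κ 1ℚ) ⊗ κ (+ 1 / 6)

  upperSlack : (S J P T D : Carrier) → Carrier
  upperSlack S J P T D =
    (P ⊗ P ⊖ T) ⊗ D ⊗ (S ⊕ κ two ⊗ (J ⊖ κ two) ⊕ κ two) ⊗ κ (+ 1 / 2)
    ⊕ D ⊗ T ⊗ (S ⊕ κ three ⊗ (J ⊖ κ two)) ⊗ κ (+ 1 / 6)
    ⊕ T

polynomialRawRing : ℕ → RawRing 0ℓ 0ℓ
polynomialRawRing n = record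
  { Carrier = Polynomial n ; _≈_ = _≡_ ; _+_ = _:+_ ; _*_ = _:*_ ; -_ = :-_
  ; 0# = con 0ℚ ; 1# = con 1ℚ }

open BoundShape +-*-rawRing id
module Poly {n} = BoundShape (polynomialRawRing n) con

splitBound : ℕ → ℕ → ℕ → ℚ
splitBound m a b = splitExpr (fromℕ a) (fromℕ m) (two ^ℚ m) (three ^ℚ m) (two ^ℚ a) (two ^ℚ b)

mergeCost : ℕ → ℕ → ℕ → ℚ
mergeCost m a b = mergeExpr (fromℕ a) (fromℕ m) (two ^ℚ m) (two ^ℚ a) (two ^ℚ b)

bound⊓ : ℕ → ℕ → ℚ
bound⊓ n k = bound n k (k ⊓ (n ∸ k))

record Split (n k m a b : ℕ) : Set where
  constructor split
  field
    k≡a+m : k ≡ a + m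
    n≡k+b+m : n ≡ k + (b + m)
    a≡0⊎b≡0 : a ≡ 0 ⊎ b ≡ 0

2^-split : ∀ a m b →
  ℕtoℚ (2 ^ (a + m + (b + m))) ≡ two ^ℚ a *ℚ two ^ℚ m *ℚ (two ^ℚ b *ℚ two ^ℚ m)
2^-split a m b = trans (2^-+ (a + m) (b + m)) (cong₂ _*ℚ_ (^ℚ-+ two a m) (^ℚ-+ two b m))

boundExpr-cong : ∀ {N K M T U V K₁ N′ K′ M′ T′ U′ V′ K₁′} →
  N ≡ N′ → K ≡ K′ → M ≡ M′ → T ≡ T′ → U ≡ U′ → V ≡ V′ → K₁ ≡ K₁′ →
  boundExpr N K M T U V K₁ ≡ boundExpr N′ K′ M′ T′ U′ V′ K₁′
boundExpr-cong refl refl refl refl refl refl refl = refl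

bound-at-split : ∀ m a b → bound (a + m + (b + m)) (a + m) m ≡ splitBound m a b
bound-at-split m a b = boundExpr-cong
  (2^-split a m b)
  (ℕtoℚ-+-fromℕ a m)
  (ℕtoℚ≡fromℕ m)
  (2^-+ a m)
  (2^*threeHalves^ a m)
  (trans (cong (λ x → ℕtoℚ (2 ^ x) *ℚ threeHalves ^ℚ m) (ℕ.m+n∸m≡n (a + m) (b + m)))
         (2^*threeHalves^ b m))
  (trans (ℕtoℚ-+ (a + m) 1) (cong (_+ℚ 1ℚ) (ℕtoℚ-+-fromℕ a m)))

split-⊓ : ∀ {m a b} → a ≡ 0 ⊎ b ≡ 0 → (a + m) ⊓ (b + m) ≡ m
split-⊓ {m} {b = b} (inj₁ refl) = ℕ.m≤n⇒m⊓n≡m (ℕ.m≤n+m m b)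
split-⊓ {m} {a} (inj₂ refl) = ℕ.m≥n⇒m⊓n≡n (ℕ.m≤n+m m a)

bound⊓-split : ∀ {n k m a b} → Split n k m a b → bound⊓ n k ≡ splitBound m a b
bound⊓-split {m = m} {a} {b} (split refl refl a≡0⊎b≡0) =
  trans (cong (bound (a + m + (b + m)) (a + m)) min≡m) (bound-at-split m a b)
  where
  min≡m : (a + m) ⊓ (a + m + (b + m) ∸ (a + m)) ≡ m
  min≡m = trans (cong ((a + m) ⊓_) (ℕ.m+n∸m≡n (a + m) (b + m))) (split-⊓ a≡0⊎b≡0)

mergeCost-split : ∀ {n k m a b} → Split n k m a b →
  ℕtoℚ (suc k * 2 ^ k + 2 ^ n) ≡ mergeCost m a b
mergeCost-split {m = m} {a} {b} (split refl refl _) =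
  trans (ℕtoℚ-+ (suc (a + m) * 2 ^ (a + m)) (2 ^ (a + m + (b + m))))
    (cong₂ _+ℚ_
      (trans (ℕtoℚ-* (suc (a + m)) (2 ^ (a + m)))
        (cong₂ _*ℚ_ (trans (ℕtoℚ-+ 1 (a + m)) (cong (1ℚ +ℚ_) (ℕtoℚ-+-fromℕ a m))) (2^-+ a m)))
      (2^-split a m b))

column-split : ∀ n → Split n 0 0 0 n
column-split n = split refl (sym (ℕ.+-identityʳ n)) (inj₁ refl)

diagonal-split : ∀ n → Split n n 0 n 0
diagonal-split n = split (sym (ℕ.+-identityʳ n)) (sym (ℕ.+-identityʳ n)) (inj₂ refl)

P-column-bound : ∀ n → ℕtoℚ (P n 0) ≡ bound⊓ n 0
P-column-bound n = begin
  ℕtoℚ (P n 0)             ≡⟨ cong ℕtoℚ (P-column-zero n) ⟩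
  ℕtoℚ (2 ^ n ∸ 1)         ≡⟨ ℕtoℚ-∸ (ℕ.m^n>0 2 n) ⟩
  ℕtoℚ (2 ^ n) -ℚ 1ℚ       ≡⟨ cong (_-ℚ 1ℚ) (ℕtoℚ-^ 2 n) ⟩
  two ^ℚ n -ℚ 1ℚ           ≡⟨ column-identity (two ^ℚ n) ⟩
  splitBound 0 0 n         ≡⟨ bound⊓-split (column-split n) ⟨
  bound⊓ n 0               ∎
  where
  open ≡-Reasoning
  column-identity : ∀ β → β -ℚ 1ℚ ≡ splitExpr 0ℚ 0ℚ 1ℚ 1ℚ 1ℚ β
  column-identity = solve 1 (λ β →
    β :- con 1ℚ := Poly.splitExpr (con 0ℚ) (con 0ℚ) (con 1ℚ) (con 1ℚ) (con 1ℚ) β) refl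

P-diagonal-bound : ∀ n → ℕtoℚ (P n n) ≡ bound⊓ n n
P-diagonal-bound n = trans (closed-form n) (sym (bound⊓-split (diagonal-split n)))
  where
  closed-form : ∀ n → ℕtoℚ (P n n) ≡ splitBound 0 n 0
  closed-form zero = refl
  closed-form (suc zero) = refl
  closed-form (suc (suc j)) = begin
    ℕtoℚ (P (2 + j) (2 + j))                                     ≡⟨ cong ℕtoℚ (P-diagonal (2 + j)) ⟩
    ℕtoℚ (x ∸ 1)                                                 ≡⟨ ℕtoℚ-∸ 1≤x ⟩
    ℕtoℚ x -ℚ 1ℚ                                                 ≡⟨ cong (_-ℚ 1ℚ) x≡ ⟩
    two ^ℚ j *ℚ (J +ℚ fromℕ 2) *ℚ (J +ℚ fromℕ 1) +ℚ two ^ℚ j *ℚ two ^ℚ 2 -ℚ 1ℚ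
                                                                 ≡⟨ diagonal-identity J (two ^ℚ j) ⟩
    splitBound 0 (2 + j) 0                                       ∎
    where
    open ≡-Reasoning
    x = 2 ^ j * (j + 2) * (j + 1) + 2 ^ (j + 2)
    J = fromℕ j
    1≤x : 1 ≤ x
    1≤x = ℕ.≤-trans (ℕ.m^n>0 2 (j + 2)) (ℕ.m≤n+m _ _)
    x≡ : ℕtoℚ x ≡ two ^ℚ j *ℚ (J +ℚ fromℕ 2) *ℚ (J +ℚ fromℕ 1) +ℚ two ^ℚ j *ℚ two ^ℚ 2
    x≡ = trans (ℕtoℚ-+ (2 ^ j * (j + 2) * (j + 1)) (2 ^ (j + 2)))
      (cong₂ _+ℚ_
        (trans (ℕtoℚ-* (2 ^ j * (j + 2)) (j + 1))
          (cong₂ _*ℚ_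
            (trans (ℕtoℚ-* (2 ^ j) (j + 2)) (cong₂ _*ℚ_ (ℕtoℚ-^ 2 j) (ℕtoℚ-+-fromℕ j 2)))
            (ℕtoℚ-+-fromℕ j 1)))
        (2^-+ j 2))
    diagonal-identity : ∀ J D →
      D *ℚ (J +ℚ fromℕ 2) *ℚ (J +ℚ fromℕ 1) +ℚ D *ℚ two ^ℚ 2 -ℚ 1ℚ
      ≡ splitExpr (1ℚ +ℚ (1ℚ +ℚ J)) 0ℚ 1ℚ 1ℚ (two *ℚ (two *ℚ D)) 1ℚ
    diagonal-identity = solve 2 (λ J D →
      D :* (J :+ con (fromℕ 2)) :* (J :+ con (fromℕ 1)) :+ D :* con (two ^ℚ 2) :- con 1ℚ
      := Poly.splitExpr (con 1ℚ :+ (con 1ℚ :+ J)) (con 0ℚ) (con 1ℚ) (con 1ℚ)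
                        (con two :* (con two :* D)) (con 1ℚ)) refl

-- The bound is a supersolution

0≤* : ∀ {p q} → 0ℚ ≤ℚ p → 0ℚ ≤ℚ q → 0ℚ ≤ℚ p *ℚ q
0≤* {p} {q} 0≤p 0≤q =
  nonNegative⁻¹ (p *ℚ q) {{nonNeg*nonNeg⇒nonNeg p {{nonNegative 0≤p}} q {{nonNegative 0≤q}}}}

0≤fromℕ : ∀ n → 0ℚ ≤ℚ fromℕ n
0≤fromℕ n = subst (0ℚ ≤ℚ_) (ℕtoℚ≡fromℕ n) (0≤ℕtoℚ n)

0≤fromℕ-two : ∀ n → 0ℚ ≤ℚ fromℕ (2 + n) -ℚ two
0≤fromℕ-two n = subst (0ℚ ≤ℚ_) (sym (cancel (fromℕ n))) (0≤fromℕ n)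
  where
  cancel : ∀ x → 1ℚ +ℚ (1ℚ +ℚ x) -ℚ two ≡ x
  cancel = solve 1 (λ x → con 1ℚ :+ (con 1ℚ :+ x) :- con two := x) refl

0≤ℕtoℚ^ : ∀ m n → 0ℚ ≤ℚ ℕtoℚ m ^ℚ n
0≤ℕtoℚ^ m n = subst (0ℚ ≤ℚ_) (ℕtoℚ-^ m n) (0≤ℕtoℚ (m ^ n))

0≤two^-1 : ∀ n → 0ℚ ≤ℚ two ^ℚ n -ℚ 1ℚ
0≤two^-1 n =
  subst (0ℚ ≤ℚ_) (trans (ℕtoℚ-∸ (ℕ.m^n>0 2 n)) (cong (_-ℚ 1ℚ) (ℕtoℚ-^ 2 n)))
    (0≤ℕtoℚ (2 ^ n ∸ 1))

0≤four^-three^ : ∀ n → 0ℚ ≤ℚ two ^ℚ n *ℚ two ^ℚ n -ℚ three ^ℚ n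
0≤four^-three^ n = subst (0ℚ ≤ℚ_) difference (0≤ℕtoℚ (4 ^ n ∸ 3 ^ n))
  where
  difference : ℕtoℚ (4 ^ n ∸ 3 ^ n) ≡ two ^ℚ n *ℚ two ^ℚ n -ℚ three ^ℚ n
  difference = trans (ℕtoℚ-∸ (ℕ.^-monoˡ-≤ n (ℕ.n≤1+n 3)))
    (cong₂ _-ℚ_ (trans (ℕtoℚ-^ 4 n) (^ℚ-distribʳ-* two two n)) (ℕtoℚ-^ 3 n))

lowerSlack-nonneg : ∀ k j → 0ℚ ≤ℚ lowerSlack (fromℕ k) (two ^ℚ k) (three ^ℚ k) (two ^ℚ j)
lowerSlack-nonneg zero j = ≤-reflexive (sym (vanishes (two ^ℚ j)))
  where
  vanishes : ∀ D → lowerSlack 0ℚ 1ℚ 1ℚ D ≡ 0ℚ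
  vanishes = solve 1 (λ D → Poly.lowerSlack (con 0ℚ) (con 1ℚ) (con 1ℚ) D := con 0ℚ) refl
lowerSlack-nonneg (suc zero) j = subst (0ℚ ≤ℚ_) (sym (reduces (two ^ℚ j))) (0≤two^-1 j)
  where
  reduces : ∀ D → lowerSlack (1ℚ +ℚ 0ℚ) (two *ℚ 1ℚ) (three *ℚ 1ℚ) D ≡ D -ℚ 1ℚ
  reduces = solve 1 (λ D →
    Poly.lowerSlack (con 1ℚ :+ con 0ℚ) (con two :* con 1ℚ) (con three :* con 1ℚ) D
    := D :- con 1ℚ) refl
lowerSlack-nonneg (suc (suc k)) j =
  +-mono-≤
    (0≤* (0≤* (0≤* (0≤four^-three^ (2 + k)) (0≤ℕtoℚ^ 2 j)) (0≤fromℕ-two k)) (0≤+/ 1 2))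
    (0≤* (0≤* (0≤* (0≤ℕtoℚ^ 3 (2 + k)) (0≤fromℕ (2 + k)))
              (+-mono-≤ (0≤* (0≤ℕtoℚ 3) (0≤two^-1 j)) (0≤ℕtoℚ 1)))
         (0≤+/ 1 6))

upperSlack-nonneg : ∀ s j → 0ℚ ≤ℚ upperSlack (fromℕ s) (fromℕ j) (two ^ℚ s) (three ^ℚ s) (two ^ℚ j)
upperSlack-nonneg zero zero = ≤ᵇ⇒≤ _
upperSlack-nonneg (suc zero) zero = ≤ᵇ⇒≤ _
upperSlack-nonneg (suc (suc s)) zero =
  subst (0ℚ ≤ℚ_) (sym (reduces (fromℕ (2 + s)) (two ^ℚ (2 + s)) (three ^ℚ (2 + s))))
    (+-mono-≤ (0≤* (0≤* (0≤four^-three^ (2 + s)) (0≤fromℕ-two s)) (0≤+/ 1 2))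
              (0≤* (0≤* (0≤ℕtoℚ^ 3 (2 + s)) (0≤fromℕ (2 + s))) (0≤+/ 1 6)))
  where
  reduces : ∀ S P T →
    upperSlack S 0ℚ P T 1ℚ ≡ (P *ℚ P -ℚ T) *ℚ (S -ℚ two) *ℚ (+ 1 / 2) +ℚ T *ℚ S *ℚ (+ 1 / 6)
  reduces = solve 3 (λ S P T →
    Poly.upperSlack S (con 0ℚ) P T (con 1ℚ)
    := (P :* P :- T) :* (S :- con two) :* con (+ 1 / 2) :+ T :* S :* con (+ 1 / 6)) refl
upperSlack-nonneg s (suc zero) =
  subst (0ℚ ≤ℚ_) (sym (reduces (fromℕ s) (two ^ℚ s) (three ^ℚ s)))
    (+-mono-≤ (0≤* (0≤four^-three^ s) (0≤fromℕ s))
              (0≤* (0≤* (0≤ℕtoℚ^ 3 s) (0≤fromℕ s)) (0≤+/ 1 3)))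
  where
  reduces : ∀ S P T →
    upperSlack S (1ℚ +ℚ 0ℚ) P T (two *ℚ 1ℚ) ≡ (P *ℚ P -ℚ T) *ℚ S +ℚ T *ℚ S *ℚ (+ 1 / 3)
  reduces = solve 3 (λ S P T →
    Poly.upperSlack S (con 1ℚ :+ con 0ℚ) P T (con two :* con 1ℚ)
    := (P :* P :- T) :* S :+ T :* S :* con (+ 1 / 3)) refl
upperSlack-nonneg s (suc (suc j)) =
  +-mono-≤
    (+-mono-≤
      (0≤* (0≤* (0≤* (0≤four^-three^ s) (0≤ℕtoℚ^ 2 (2 + j)))
                (+-mono-≤ (+-mono-≤ (0≤fromℕ s) (0≤* (0≤ℕtoℚ 2) (0≤fromℕ-two j))) (0≤ℕtoℚ 2)))
           (0≤+/ 1 2))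
      (0≤* (0≤* (0≤* (0≤ℕtoℚ^ 2 (2 + j)) (0≤ℕtoℚ^ 3 s))
                (+-mono-≤ (0≤fromℕ s) (0≤* (0≤ℕtoℚ 3) (0≤fromℕ-two j))))
           (0≤+/ 1 6)))
    (0≤ℕtoℚ^ 3 s)

≤-via-slack : ∀ {x y s} → x ≡ y +ℚ s → 0ℚ ≤ℚ s → y ≤ℚ x
≤-via-slack {x} {y} {s} x≡y+s 0≤s = begin
  y         ≡⟨ +-identityʳ y ⟨
  y +ℚ 0ℚ   ≤⟨ +-monoʳ-≤ y 0≤s ⟩
  y +ℚ s    ≡⟨ x≡y+s ⟨
  x         ∎
  where open ≤-Reasoning

lower-step : ∀ k j →
  splitBound (suc k) 0 j +ℚ splitBound k 0 (2 + j) +ℚ mergeCost k 0 (2 + j)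
  ≤ℚ splitBound (suc k) 0 (suc j)
lower-step k j =
  ≤-via-slack (identity (fromℕ k) (two ^ℚ k) (three ^ℚ k) (two ^ℚ j)) (lowerSlack-nonneg k j)
  where
  identity : ∀ K P T D →
    splitExpr 0ℚ (1ℚ +ℚ K) (two *ℚ P) (three *ℚ T) 1ℚ (two *ℚ D)
    ≡ splitExpr 0ℚ (1ℚ +ℚ K) (two *ℚ P) (three *ℚ T) 1ℚ D
      +ℚ splitExpr 0ℚ K P T 1ℚ (two *ℚ (two *ℚ D))
      +ℚ mergeExpr 0ℚ K P 1ℚ (two *ℚ (two *ℚ D))
      +ℚ lowerSlack K P T D
  identity = solve 4 (λ K P T D →
    Poly.splitExpr (con 0ℚ) (con 1ℚ :+ K) (con two :* P) (con three :* T) (con 1ℚ)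
                   (con two :* D)
    := Poly.splitExpr (con 0ℚ) (con 1ℚ :+ K) (con two :* P) (con three :* T) (con 1ℚ) D
      :+ Poly.splitExpr (con 0ℚ) K P T (con 1ℚ) (con two :* (con two :* D))
      :+ Poly.mergeExpr (con 0ℚ) K P (con 1ℚ) (con two :* (con two :* D))
      :+ Poly.lowerSlack K P T D) refl

middle-step : ∀ k → splitBound k 1 0 +ℚ splitBound k 0 1 +ℚ mergeCost k 0 1 ≤ℚ splitBound (suc k) 0 0
middle-step k = ≤-reflexive (sym (identity (fromℕ k) (two ^ℚ k) (three ^ℚ k)))
  where
  identity : ∀ K P T →
    splitExpr 0ℚ (1ℚ +ℚ K) (two *ℚ P) (three *ℚ T) 1ℚ 1ℚ
    ≡ splitExpr (1ℚ +ℚ 0ℚ) K P T (two *ℚ 1ℚ) 1ℚ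
      +ℚ splitExpr 0ℚ K P T 1ℚ (two *ℚ 1ℚ)
      +ℚ mergeExpr 0ℚ K P 1ℚ (two *ℚ 1ℚ)
  identity = solve 3 (λ K P T →
    Poly.splitExpr (con 0ℚ) (con 1ℚ :+ K) (con two :* P) (con three :* T) (con 1ℚ)
                   (con 1ℚ)
    := Poly.splitExpr (con 1ℚ :+ con 0ℚ) K P T (con two :* con 1ℚ) (con 1ℚ)
      :+ Poly.splitExpr (con 0ℚ) K P T (con 1ℚ) (con two :* con 1ℚ)
      :+ Poly.mergeExpr (con 0ℚ) K P (con 1ℚ) (con two :* con 1ℚ)) refl

upper-step : ∀ s j →
  splitBound s (2 + j) 0 +ℚ splitBound (suc s) j 0 +ℚ mergeCost (suc s) j 0
  ≤ℚ splitBound (suc s) (suc j) 0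
upper-step s j =
  ≤-via-slack (identity (fromℕ s) (fromℕ j) (two ^ℚ s) (three ^ℚ s) (two ^ℚ j)) (upperSlack-nonneg s j)
  where
  identity : ∀ S J P T D →
    splitExpr (1ℚ +ℚ J) (1ℚ +ℚ S) (two *ℚ P) (three *ℚ T) (two *ℚ D) 1ℚ
    ≡ splitExpr (1ℚ +ℚ (1ℚ +ℚ J)) S P T (two *ℚ (two *ℚ D)) 1ℚ
      +ℚ splitExpr J (1ℚ +ℚ S) (two *ℚ P) (three *ℚ T) D 1ℚ
      +ℚ mergeExpr J (1ℚ +ℚ S) (two *ℚ P) D 1ℚ
      +ℚ upperSlack S J P T D
  identity = solve 5 (λ S J P T D →
    Poly.splitExpr (con 1ℚ :+ J) (con 1ℚ :+ S) (con two :* P) (con three :* T)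
                   (con two :* D) (con 1ℚ)
    := Poly.splitExpr (con 1ℚ :+ (con 1ℚ :+ J)) S P T (con two :* (con two :* D)) (con 1ℚ)
      :+ Poly.splitExpr J (con 1ℚ :+ S) (con two :* P) (con three :* T) D (con 1ℚ)
      :+ Poly.mergeExpr J (con 1ℚ :+ S) (con two :* P) D (con 1ℚ)
      :+ Poly.upperSlack S J P T D) refl

<-cases : (Q : ℕ → ℕ → Set) →
  (∀ k j → Q (suc k + suc (k + j)) k) → (∀ k → Q (suc k + k) k) →
  (∀ s j → Q (suc (suc (s + j)) + s) (suc (s + j))) →
  ∀ {n k} → k < n → Q n k
<-cases Q lower middle upper {k = k} k<n with ℕ.m≤n⇒∃[o]m+o≡n k<n
... | o , refl with compare o k
... | less o j = upper o j
... | equal k = middle k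
... | greater k j = lower k j

supersolution-via-splits : ∀ {n k m₁ a₁ b₁ m₂ a₂ b₂ m a b} →
  Split n (suc k) m₁ a₁ b₁ → Split n k m₂ a₂ b₂ → Split (suc n) (suc k) m a b →
  splitBound m₁ a₁ b₁ +ℚ splitBound m₂ a₂ b₂ +ℚ mergeCost m₂ a₂ b₂ ≤ℚ splitBound m a b →
  SupersolutionAt bound⊓ n k
supersolution-via-splits s₁ s₂ s =
  subst₂ _≤ℚ_
    (sym (cong₂ _+ℚ_ (cong₂ _+ℚ_ (bound⊓-split s₁) (bound⊓-split s₂)) (mergeCost-split s₂)))
    (sym (bound⊓-split s))

lower-regime : ∀ k j → SupersolutionAt bound⊓ (suc k + suc (k + j)) k
lower-regime k j = supersolution-via-splits s₁ s₂ s (lower-step k j)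
  where
  s₁ : Split (suc k + suc (k + j)) (suc k) (suc k) 0 j
  s₁ = split refl (solveℕ (k ∷ j ∷ [])) (inj₁ refl)
  s₂ : Split (suc k + suc (k + j)) k k 0 (2 + j)
  s₂ = split refl (solveℕ (k ∷ j ∷ [])) (inj₁ refl)
  s : Split (suc (suc k + suc (k + j))) (suc k) (suc k) 0 (suc j)
  s = split refl (solveℕ (k ∷ j ∷ [])) (inj₁ refl)

middle-regime : ∀ k → SupersolutionAt bound⊓ (suc k + k) k
middle-regime k = supersolution-via-splits s₁ s₂ s (middle-step k)
  where
  s₁ : Split (suc k + k) (suc k) k 1 0
  s₁ = split refl refl (inj₂ refl)
  s₂ : Split (suc k + k) k k 0 1
  s₂ = split refl (solveℕ (k ∷ [])) (inj₁ refl)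
  s : Split (suc (suc k + k)) (suc k) (suc k) 0 0
  s = split refl (solveℕ (k ∷ [])) (inj₁ refl)

upper-regime : ∀ s j → SupersolutionAt bound⊓ (suc (suc (s + j)) + s) (suc (s + j))
upper-regime s j = supersolution-via-splits s₁ s₂ s′ (upper-step s j)
  where
  s₁ : Split (suc (suc (s + j)) + s) (suc (suc (s + j))) s (2 + j) 0
  s₁ = split (solveℕ (s ∷ j ∷ [])) refl (inj₂ refl)
  s₂ : Split (suc (suc (s + j)) + s) (suc (s + j)) (suc s) j 0
  s₂ = split (solveℕ (s ∷ j ∷ [])) (solveℕ (s ∷ j ∷ [])) (inj₂ refl)
  s′ : Split (suc (suc (suc (s + j)) + s)) (suc (suc (s + j))) (suc s) (suc j) 0
  s′ = split (solveℕ (s ∷ j ∷ [])) (solveℕ (s ∷ j ∷ [])) (inj₂ refl)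

bound⊓-supersolution : Supersolution bound⊓
bound⊓-supersolution = <-cases (SupersolutionAt bound⊓) lower-regime middle-regime upper-regime

mainTheorem13 : (n k : ℕ) → k ≤ n →
    ℕtoℚ (P n k) ≤ℚ bound n k (k ⊓ (n ∸ k))
mainTheorem13 n k =
  P≤supersolution bound⊓
    (λ n → ≤-reflexive (P-column-bound n))
    (λ n → ≤-reflexive (P-diagonal-bound n))
    bound⊓-supersolution
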